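{- Let $\mathcal{B}_{\mathcal G}$ be the set of partitions $\lambda=(\lambda_1>\lambda_2>\cdots>\lambda_\ell)$ into distinct positive parts such that $1\le\lambda_{2i-1}-\lambda_{2i}\le2$ whenever $2i\le\ell$, $\lambda_{2i}-\lambda_{2i+1}=2$ whenever $2i+1\le\ell$, and the smallest part $\lambda_\ell$ is $1$ or $2$, with $\lambda_\ell=2$ required when $\ell$ is even. For a partition let $|\lambda_o|=\lambda_1+\lambda_3+\lambda_5+\cdots$ and $|\lambda_e|=\lambda_2+\lambda_4+\cdots$. For integers $n,h$ let $B_G(n,h)=\sum x^{|\lambda_o|}y^{|\lambda_e|}$, the sum over all $\lambda\in\mathcal{B}_{\mathcal G}$ with exactly $n$ parts and largest part $h$. Then for all integers $n\ge1$ and $h\ge0$, $$B_G(2n-1,3n+h-2)=x^{\frac{3n^2-n}{2}+\frac{h^2+h}{2}}y^{\frac{3n^2-3n}{2}+\frac{h^2-h}{2}}{n\brack h}_{xy},\qquad B_G(2n,3n+h)=x^{\frac{3n^2+3n}{2}+\frac{h^2+h}{2}}y^{\frac{3n^2+n}{2}+\frac{h^2-h}{2}}{n\brack h}_{xy}.$$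
   Context: The Gaussian coefficient is ${a+b\brack b}_t=\frac{(t;t)_{a+b}}{(t;t)_a(t;t)_b}$ if $a,b\ge0$ and $0$ otherwise, with $(a;t)_n=\prod_{i=0}^{n-1}(1-at^i)$; here $t=xy$. -}

module Defs where

open import Data.Nat using (ℕ; zero; suc; _+_; _∸_; _≤_; _>_; _≟_; _≤?_; _>?_; _⊔_; _%_)
open import Data.List using (List; []; _∷_; map; concatMap; upTo; filter; last; foldr; length)
open import Data.List.Relation.Unary.All using (All; all?)
open import Data.List.Relation.Unary.Linked using (Linked; linked?)
open import Data.Maybe using (Maybe; just; nothing)
open import Data.Product using (_×_)
open import Data.Sum using (_⊎_)
open import Data.Unit using (⊤; tt)
open import Data.Empty using (⊥)
open import Relation.Nullary using (Dec; yes; no)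
open import Relation.Nullary.Decidable using (_×-dec_; _⊎-dec_; _→-dec_)
open import Relation.Binary.PropositionalEquality using (_≡_)
open import Algebra.Bundles using (CommutativeRing)

-- Partitions are lists of parts  λ₁ ∷ λ₂ ∷ … ∷ λ_ℓ ∷ []  (positions 1..ℓ).

-- Gap conditions, starting at an odd position (pair λ_{2i-1}, λ_{2i})
-- resp. at an even position (pair λ_{2i}, λ_{2i+1}).
GapsOdd  : List ℕ → Set
GapsEven : List ℕ → Set
GapsOdd  (a ∷ b ∷ r) = (1 ≤ a ∸ b × a ∸ b ≤ 2) × GapsEven (b ∷ r)
GapsOdd  _           = ⊤
GapsEven (a ∷ b ∷ r) = (a ∸ b ≡ 2) × GapsOdd (b ∷ r)
GapsEven _           = ⊤

SmallestOK : List ℕ → Set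
SmallestOK λs with last λs
... | nothing = ⊥
... | just s  = (s ≡ 1 ⊎ s ≡ 2) × (length λs % 2 ≡ 0 → s ≡ 2)

IsBG : List ℕ → Set
IsBG λs = Linked _>_ λs × All (λ p → 1 ≤ p) λs × GapsOdd λs × SmallestOK λs

HasShape : ℕ → ℕ → List ℕ → Set
HasShape n h λs = length λs ≡ n × foldr _⊔_ 0 λs ≡ h

gapsOdd?  : (l : List ℕ) → Dec (GapsOdd l)
gapsEven? : (l : List ℕ) → Dec (GapsEven l)
gapsOdd? (a ∷ b ∷ r) = ((1 ≤? a ∸ b) ×-dec (a ∸ b ≤? 2)) ×-dec gapsEven? (b ∷ r)
gapsOdd? (_ ∷ []) = yes tt
gapsOdd? [] = yes tt
gapsEven? (a ∷ b ∷ r) = (a ∸ b ≟ 2) ×-dec gapsOdd? (b ∷ r)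
gapsEven? (_ ∷ []) = yes tt
gapsEven? [] = yes tt

smallestOK? : (l : List ℕ) → Dec (SmallestOK l)
smallestOK? λs with last λs
... | nothing = no (λ ())
... | just s  = ((s ≟ 1) ⊎-dec (s ≟ 2)) ×-dec ((length λs % 2 ≟ 0) →-dec (s ≟ 2))

isBG? : (l : List ℕ) → Dec (IsBG l)
isBG? l = linked? _>?_ l ×-dec all? (λ p → 1 ≤? p) l ×-dec gapsOdd? l ×-dec smallestOK? l

shapeBG? : (n h : ℕ) → (l : List ℕ) → Dec (HasShape n h l × IsBG l)
shapeBG? n h l = ((length l ≟ n) ×-dec (foldr _⊔_ 0 l ≟ h)) ×-dec isBG? l

candidates : ℕ → ℕ → List (List ℕ)
candidates zero    h = [] ∷ []
candidates (suc n) h = concatMap (λ a → map (a ∷_) (candidates n h)) (upTo (suc h))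

BGset : ℕ → ℕ → List (List ℕ)
BGset n h = filter (shapeBG? n h) (candidates n h)

oddSum  : List ℕ → ℕ
evenSum : List ℕ → ℕ
oddSum  []      = 0
oddSum  (a ∷ r) = a + evenSum r
evenSum []      = 0
evenSum (a ∷ r) = oddSum r

-- Ring-valued notions, for an arbitrary commutative ring (x, y are
-- elements of it; the polynomial ring ℤ[x,y] is one instance).

module Ring {c ℓ} (R : CommutativeRing c ℓ) where
  open CommutativeRing R using (Carrier; _≈_; 0#; 1#; _*_; _-_) renaming (_+_ to _+ᴿ_)

  pw : Carrier → ℕ → Carrier
  pw a zero    = 1#
  pw a (suc k) = a * pw a k

  poch : Carrier → Carrier → ℕ → Carrier
  poch a t zero    = 1#
  poch a t (suc k) = poch a t k * (1# - a * pw t k)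

  sumR : List Carrier → Carrier
  sumR = foldr _+ᴿ_ 0#

  BG : Carrier → Carrier → ℕ → ℕ → Carrier
  BG x y n h = sumR (map (λ λs → pw x (oddSum λs) * pw y (evenSum λs)) (BGset n h))

  -- "lhs = m · [a+b brack b]_t", with [a+b brack b]_t = (t;t)_{a+b}/((t;t)_a (t;t)_b)
  -- for a,b ≥ 0 (cross-multiplied) and 0 otherwise; here a+b = n, b = h, a = n ∸ h.
  EqMonGauss : Carrier → Carrier → Carrier → ℕ → ℕ → Set ℓ
  EqMonGauss t lhs m n h =
    (h ≤ n → lhs * (poch t t (n ∸ h) * poch t t h) ≈ m * poch t t n)
    × (h > n → lhs ≈ 0#)

-- A partition in 𝓑_𝓖 is built from the bottom by repeatedly putting a pair (a, b) on top of a
-- partition with largest part c, where b = c + 2 and a = b + d with d ∈ {1, 2}.  Fixing the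
-- number of pairs and the largest part, the choice of d on the top pair gives a q-Pascal
-- recurrence for B_G in which the pair with d = 1 contributes the factor (xy)^h; so B_G is a
-- monomial times the Gaussian coefficient defined by that recurrence, which in turn satisfies
-- [n brack h] (t;t)_{n-h} (t;t)_h = (t;t)_n.  The two statements differ only in the bottom
-- layer: the partitions (1), (2) for an odd number of parts and (3,2), (4,2) for an even one.
module Submission where

open import Defs
open import Data.Nat using (ℕ; zero; suc; _+_; _∸_; _≤_; _<_; _>_; _⊔_; _%_; z≤n; s≤s; z<s)
import Data.Nat.Properties as ℕ
open import Data.Nat.DivMod using ([m+n]%n≡m%n; m*n/n≡m)
open import Data.Nat.Tactic.RingSolver using (solve-∀)
open import Data.List using (List; []; _∷_; map; concatMap; upTo; length; foldr; last; cartesianProductWith; _++_)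
open import Data.List.Properties using (∷-injective)
open import Data.List.Relation.Unary.All as All using (All; []; _∷_)
open import Data.List.Relation.Unary.Any using (here)
open import Data.List.Relation.Unary.AllPairs using ([]; _∷_)
open import Data.List.Relation.Unary.Linked using (Linked; _∷_)
open import Data.List.Relation.Unary.Unique.Propositional using (Unique)
import Data.List.Relation.Unary.Unique.Propositional.Properties as Unique
open import Data.List.Membership.Propositional using (_∈_)
open import Data.List.Membership.Propositional.Properties
  using (∈-cartesianProductWith⁺; ∈-upTo⁺; ∈-filter⁺; ∈-filter⁻; ∈-map⁺; ∈-map⁻; ∈-++⁺ˡ; ∈-++⁺ʳ; ∈-++⁻)
open import Data.List.Membership.Propositional.Properties.WithK using (unique∧set⇒bag)
open import Data.List.Relation.Binary.BagAndSetEquality using (∼bag⇒↭)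
open import Data.List.Relation.Binary.Permutation.Propositional using (_↭_; ↭⇒↭ₛ′)
import Data.List.Relation.Binary.Permutation.Propositional.Properties as ↭
import Data.List.Relation.Binary.Permutation.Setoid.Properties as ↭ₛ
open import Data.Product using (_×_; _,_; proj₁; proj₂; ∃-syntax)
open import Data.Sum using (_⊎_; inj₁; inj₂; [_,_]′)
open import Data.Maybe using (just; nothing)
open import Function using (id; _∘_)
open import Function.Bundles using (_⇔_; mk⇔; Equivalence)
open import Function.Construct.Symmetry using (⇔-sym)
open import Function.Construct.Composition using (_⇔-∘_)
open import Relation.Nullary using (¬_)
open import Relation.Nullary.Decidable using (from-yes)
open import Relation.Binary.PropositionalEquality as ≡ using (_≡_; refl)
open import Algebra.Bundles using (CommutativeRing)
import Algebra.Properties.Ring as RingProperties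
import Algebra.Solver.Ring.NaturalCoefficients.Default as SemiringSolver

IsBG[_,_] : ℕ → ℕ → List ℕ → Set
IsBG[ n , h ] λs = HasShape n h λs × IsBG λs

concatMap-∷≡cartesianProductWith : ∀ {A : Set} (xs : List A) (ys : List (List A)) →
  concatMap (λ a → map (a ∷_) ys) xs ≡ cartesianProductWith _∷_ xs ys
concatMap-∷≡cartesianProductWith []       ys = refl
concatMap-∷≡cartesianProductWith (x ∷ xs) ys =
  ≡.cong (map (x ∷_) ys ++_) (concatMap-∷≡cartesianProductWith xs ys)

candidates-unique : ∀ n h → Unique (candidates n h)
candidates-unique zero    h = [] ∷ []
candidates-unique (suc n) h =
  ≡.subst Unique (≡.sym (concatMap-∷≡cartesianProductWith (upTo (suc h)) (candidates n h)))
    (Unique.cartesianProductWith⁺ _∷_ ∷-injective (Unique.upTo⁺ (suc h)) (candidates-unique n h))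

∈-candidates : ∀ {h} z → All (_≤ h) z → z ∈ candidates (length z) h
∈-candidates     []      []            = here refl
∈-candidates {h} (a ∷ z) (a≤h ∷ z≤h) =
  ≡.subst (_ ∈_) (≡.sym (concatMap-∷≡cartesianProductWith (upTo (suc h)) (candidates (length z) h)))
    (∈-cartesianProductWith⁺ _∷_ (∈-upTo⁺ (s≤s a≤h)) (∈-candidates z z≤h))

All-≤-foldr-⊔ : ∀ z → All (_≤ foldr _⊔_ 0 z) z
All-≤-foldr-⊔ []      = []
All-≤-foldr-⊔ (a ∷ z) = ℕ.m≤m⊔n a _ ∷ All.map (λ b≤ → ℕ.≤-trans b≤ (ℕ.m≤n⊔m a _)) (All-≤-foldr-⊔ z)

∈-BGset⇔ : ∀ {n h z} → z ∈ BGset n h ⇔ IsBG[ n , h ] z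
∈-BGset⇔ {n} {h} {z} = mk⇔ (λ z∈ → proj₂ (∈-filter⁻ (shapeBG? n h) {xs = candidates n h} z∈)) from
  where
  from : IsBG[ n , h ] z → z ∈ BGset n h
  from bg@((refl , refl) , _) = ∈-filter⁺ (shapeBG? n h) (∈-candidates z (All-≤-foldr-⊔ z)) bg

BGset-unique : ∀ n h → Unique (BGset n h)
BGset-unique n h = Unique.filter⁺ (shapeBG? n h) (candidates-unique n h)

OneOrTwo : ℕ → Set
OneOrTwo d = d ≡ 1 ⊎ d ≡ 2

1≤d≤2⇒OneOrTwo : ∀ {d} → 1 ≤ d → d ≤ 2 → OneOrTwo d
1≤d≤2⇒OneOrTwo {1}                 _ _ = inj₁ refl
1≤d≤2⇒OneOrTwo {2}                 _ _ = inj₂ refl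
1≤d≤2⇒OneOrTwo {suc (suc (suc _))} _ (s≤s (s≤s ()))

OneOrTwo⇒1≤d≤2 : ∀ {d} → OneOrTwo d → 1 ≤ d × d ≤ 2
OneOrTwo⇒1≤d≤2 (inj₁ refl) = s≤s z≤n , s≤s z≤n
OneOrTwo⇒1≤d≤2 (inj₂ refl) = s≤s z≤n , ℕ.≤-refl

gap⇒OneOrTwo : ∀ {a b} → b < a → 1 ≤ a ∸ b → a ∸ b ≤ 2 → ∃[ d ] OneOrTwo d × a ≡ d + b
gap⇒OneOrTwo b<a 1≤ ≤2 = _ , 1≤d≤2⇒OneOrTwo 1≤ ≤2 , ≡.sym (ℕ.m∸n+n≡m (ℕ.<⇒≤ b<a))

pair : ℕ → ℕ → List ℕ → List ℕ
pair d c r = d + (2 + c) ∷ 2 + c ∷ r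

pair-injective : ∀ d c {r r′} → pair d c r ≡ pair d c r′ → r ≡ r′
pair-injective d c = proj₂ ∘ ∷-injective ∘ proj₂ ∘ ∷-injective

foldr-⊔-decreasing : ∀ {c r} → Linked _>_ (c ∷ r) → foldr _⊔_ 0 (c ∷ r) ≡ c
foldr-⊔-decreasing {c} {[]}    _          = ℕ.⊔-identityʳ c
foldr-⊔-decreasing {c} {d ∷ r} (c>d ∷ lk) =
  ≡.trans (≡.cong (c ⊔_) (foldr-⊔-decreasing lk)) (ℕ.m≥n⇒m⊔n≡m (ℕ.<⇒≤ c>d))

SmallestOK-∷∷ : ∀ a b c r → SmallestOK (a ∷ b ∷ c ∷ r) ⇔ SmallestOK (c ∷ r)
SmallestOK-∷∷ a b c r with last (c ∷ r)
... | nothing = mk⇔ id id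
... | just s  = mk⇔ (λ (s≡1∨2 , even) → s≡1∨2 , λ e → even (≡.trans parity e))
                    (λ (s≡1∨2 , even) → s≡1∨2 , λ e → even (≡.trans (≡.sym parity) e))
  where
  parity : suc (suc (length (c ∷ r))) % 2 ≡ length (c ∷ r) % 2
  parity = ≡.trans (≡.cong (_% 2) (ℕ.+-comm 2 (length (c ∷ r)))) ([m+n]%n≡m%n (length (c ∷ r)) 2)

IsBG-pair : ∀ {d L c r} → OneOrTwo d → IsBG[ L , c ] r → IsBG[ 2 + L , d + (2 + c) ] (pair d c r)
IsBG-pair {r = []} _ (_ , _ , _ , _ , ())
IsBG-pair {d} {L} {c} {c′ ∷ r} d∈ ((len , max≡c) , lk , pos , gaps , small)
  with ≡.trans (≡.sym (foldr-⊔-decreasing lk)) max≡c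
... | refl =
  (≡.cong (suc ∘ suc) len , foldr-⊔-decreasing lk′) , lk′ , pos′ , gaps′ ,
  Equivalence.from (SmallestOK-∷∷ _ _ c r) small
  where
  d>0 : d > 0
  d>0 = proj₁ (OneOrTwo⇒1≤d≤2 d∈)
  lk′ : Linked _>_ (pair d c (c ∷ r))
  lk′ = ℕ.m<n+m (2 + c) d>0 ∷ ℕ.m<n+m c z<s ∷ lk
  pos′ : All (1 ≤_) (pair d c (c ∷ r))
  pos′ = ℕ.≤-trans (s≤s z≤n) (ℕ.m<n+m (2 + c) d>0) ∷ s≤s z≤n ∷ pos
  gaps′ : GapsOdd (pair d c (c ∷ r))
  gaps′ = ≡.subst (λ k → 1 ≤ k × k ≤ 2) (≡.sym (ℕ.m+n∸n≡m d (2 + c))) (OneOrTwo⇒1≤d≤2 d∈) ,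
          ℕ.m+n∸n≡m 2 c , gaps

IsBG-unpair : ∀ {L H a b c r} → IsBG[ 2 + L , H ] (a ∷ b ∷ c ∷ r) →
  ∃[ d ] OneOrTwo d × a ∷ b ∷ c ∷ r ≡ pair d c (c ∷ r) × H ≡ a × IsBG[ L , c ] (c ∷ r)
IsBG-unpair {a = a} {b} {c} {r}
  ((len , max≡H) , lk@(b<a ∷ c<b ∷ lk′) , _ ∷ _ ∷ pos , ((1≤ , ≤2) , b∸c≡2 , gaps) , small)
  with gap⇒OneOrTwo b<a 1≤ ≤2
... | d , d∈ , a≡d+b =
  d , d∈ , ≡.cong₂ (λ u v → u ∷ v ∷ c ∷ r) (≡.trans a≡d+b (≡.cong (d +_) b≡2+c)) b≡2+c ,
  ≡.trans (≡.sym max≡H) (foldr-⊔-decreasing lk) ,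
  (ℕ.suc-injective (ℕ.suc-injective len) , foldr-⊔-decreasing lk′) , lk′ , pos , gaps ,
  Equivalence.to (SmallestOK-∷∷ a b c r) small
  where
  b≡2+c : b ≡ 2 + c
  b≡2+c = ≡.trans (≡.sym (ℕ.m∸n+n≡m (ℕ.<⇒≤ c<b))) (≡.cong (_+ c) b∸c≡2)

IsBG-map-pair : ∀ {d L c rs z} → OneOrTwo d → (∀ {r} → r ∈ rs → IsBG[ L , c ] r) →
                z ∈ map (pair d c) rs → IsBG[ 2 + L , d + (2 + c) ] z
IsBG-map-pair d∈ rs-BG z∈ with ∈-map⁻ _ z∈
... | _ , r∈ , refl = IsBG-pair d∈ (rs-BG r∈)

module InCommutativeRing {a ℓ} (R : CommutativeRing a ℓ) where
  open CommutativeRing R hiding (refl) renaming (_+_ to _⊕_)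
  open CommutativeRing R using () renaming (refl to ≈-refl)
  open Defs.Ring R
  open RingProperties ring using (-‿distribʳ-*)
  open SemiringSolver commutativeSemiring using (solve; _:+_; _:*_; _:=_; con)
  open import Relation.Binary.Reasoning.Setoid setoid

  ≡⇒≈ : ∀ {u v} → u ≡ v → u ≈ v
  ≡⇒≈ refl = ≈-refl

  sumR-↭ : ∀ {xs ys} → xs ↭ ys → sumR xs ≈ sumR ys
  sumR-↭ p = ↭ₛ.foldr-commMonoid setoid +-isCommutativeMonoid (↭⇒↭ₛ′ isEquivalence p)

  sumR-map-unique : ∀ {A : Set} (f : A → Carrier) {xs ys} → Unique xs → Unique ys →
                    (∀ {z} → z ∈ xs ⇔ z ∈ ys) → sumR (map f xs) ≈ sumR (map f ys)
  sumR-map-unique f xs! ys! xs≈ys = sumR-↭ (↭.map⁺ f (∼bag⇒↭ (unique∧set⇒bag xs! ys! xs≈ys)))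

  sumR-map-++ : ∀ {A : Set} (f : A → Carrier) xs ys →
                sumR (map f (xs ++ ys)) ≈ sumR (map f xs) ⊕ sumR (map f ys)
  sumR-map-++ f []       ys = sym (+-identityˡ _)
  sumR-map-++ f (z ∷ xs) ys = trans (+-congˡ (sumR-map-++ f xs ys)) (sym (+-assoc _ _ _))

  sumR-map-map : ∀ {A : Set} (f : A → Carrier) (g : A → A) {u} →
                 (∀ z → f (g z) ≈ u * f z) → ∀ zs → sumR (map f (map g zs)) ≈ u * sumR (map f zs)
  sumR-map-map f g fg≈ []       = sym (zeroʳ _)
  sumR-map-map f g fg≈ (z ∷ zs) = trans (+-cong (fg≈ z) (sumR-map-map f g fg≈ zs)) (sym (distribˡ _ _ _))

  pw-+ : ∀ u i j → pw u (i + j) ≈ pw u i * pw u j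
  pw-+ u zero    j = sym (*-identityˡ _)
  pw-+ u (suc i) j = trans (*-congˡ (pw-+ u i j)) (sym (*-assoc _ _ _))

  pw-*-distrib : ∀ u v n → pw (u * v) n ≈ pw u n * pw v n
  pw-*-distrib u v zero    = sym (*-identityˡ 1#)
  pw-*-distrib u v (suc n) = trans (*-congˡ (pw-*-distrib u v n))
    (solve 4 (λ u v p q → (u :* v) :* (p :* q) := (u :* p) :* (v :* q)) ≈-refl u v (pw u n) (pw v n))

  1-a+a[1-b]≈1-ab : ∀ u v → (1# - u) ⊕ u * (1# - v) ≈ 1# - u * v
  1-a+a[1-b]≈1-ab u v = begin
    (1# - u) ⊕ u * (1# - v)     ≈⟨ solve 3 (λ u u⁻ v⁻ → (con 1 :+ u⁻) :+ u :* (con 1 :+ v⁻)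
                                                        := con 1 :+ ((u⁻ :+ u) :+ u :* v⁻))
                                         ≈-refl u (- u) (- v) ⟩
    1# ⊕ ((- u ⊕ u) ⊕ u * - v)  ≈⟨ +-congˡ (+-cong (-‿inverseˡ u) (sym (-‿distribʳ-* u v))) ⟩
    1# ⊕ (0# - u * v)           ≈⟨ +-congˡ (+-identityˡ _) ⟩
    1# - u * v                  ∎

  gauss : Carrier → ℕ → ℕ → Carrier
  gauss t n       zero    = 1#
  gauss t zero    (suc h) = 0#
  gauss t (suc n) (suc h) = gauss t n h ⊕ pw t (suc h) * gauss t n (suc h)

  gauss-above : ∀ t {n h} → n < h → gauss t n h ≈ 0#
  gauss-above t {zero}  {suc h} _         = ≈-refl
  gauss-above t {suc n} {suc h} (s≤s n<h) =
    trans (+-cong (gauss-above t n<h) (*-congˡ (gauss-above t (ℕ.m<n⇒m<1+n n<h))))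
          (trans (+-identityˡ _) (zeroʳ _))

  gauss-diag : ∀ t n → gauss t n n ≈ 1#
  gauss-diag t zero    = ≈-refl
  gauss-diag t (suc n) =
    trans (+-cong (gauss-diag t n) (*-congˡ (gauss-above t (ℕ.n<1+n n))))
          (trans (+-congˡ (zeroʳ _)) (+-identityʳ _))

  pascal-cross : ∀ {G₁ G₂ P Q₁ Q₂ A B} →
    G₁ * ((Q₁ * (1# - B)) * Q₂) ≈ P →
    G₂ * (Q₁ * (Q₂ * (1# - A))) ≈ P →
    (G₁ ⊕ A * G₂) * ((Q₁ * (1# - B)) * (Q₂ * (1# - A))) ≈ P * (1# - A * B)
  pascal-cross {G₁} {G₂} {P} {Q₁} {Q₂} {A} {B} e₁ e₂ = begin
    (G₁ ⊕ A * G₂) * ((Q₁ * V) * (Q₂ * U))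
      ≈⟨ solve 7 (λ g₁ g₂ q₁ q₂ a u v → (g₁ :+ a :* g₂) :* ((q₁ :* v) :* (q₂ :* u))
                   := (g₁ :* ((q₁ :* v) :* q₂)) :* u :+ (a :* v) :* (g₂ :* (q₁ :* (q₂ :* u))))
                 ≈-refl G₁ G₂ Q₁ Q₂ A U V ⟩
    (G₁ * ((Q₁ * V) * Q₂)) * U ⊕ (A * V) * (G₂ * (Q₁ * (Q₂ * U)))
      ≈⟨ +-cong (*-congʳ e₁) (*-congˡ e₂) ⟩
    P * U ⊕ (A * V) * P
      ≈⟨ solve 4 (λ p u a v → p :* u :+ (a :* v) :* p := p :* (u :+ a :* v)) ≈-refl P U A V ⟩
    P * (U ⊕ A * V)
      ≈⟨ *-congˡ (1-a+a[1-b]≈1-ab A B) ⟩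
    P * (1# - A * B) ∎
    where
    U = 1# - A
    V = 1# - B

  gauss-poch-+ : ∀ t r h → gauss t (r + h) h * (poch t t r * poch t t h) ≈ poch t t (r + h)
  gauss-poch-+ t zero    h       = trans (*-congʳ (gauss-diag t h)) (trans (*-identityˡ _) (*-identityˡ _))
  gauss-poch-+ t (suc r) zero    =
    trans (*-identityˡ _) (trans (*-identityʳ _) (≡⇒≈ (≡.cong (poch t t) (≡.sym (ℕ.+-identityʳ (suc r))))))
  gauss-poch-+ t (suc r) (suc h) = begin
    gauss t (suc r + suc h) (suc h) * (poch t t (suc r) * poch t t (suc h))
      ≈⟨ pascal-cross shifted (gauss-poch-+ t r (suc h)) ⟩
    poch t t (r + suc h) * (1# - pw t (suc h) * pw t (suc r))
      ≈⟨ *-congˡ (+-congˡ (-‿cong (trans (*-comm _ _) (sym (pw-+ t (suc r) (suc h)))))) ⟩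
    poch t t (suc r + suc h) ∎
    where
    shifted : gauss t (r + suc h) h * (poch t t (suc r) * poch t t h) ≈ poch t t (r + suc h)
    shifted = ≡.subst (λ N → gauss t N h * (poch t t (suc r) * poch t t h) ≈ poch t t N)
                      (≡.sym (ℕ.+-suc r h)) (gauss-poch-+ t (suc r) h)

  gauss-poch : ∀ t {n h} → h ≤ n → gauss t n h * (poch t t (n ∸ h) * poch t t h) ≈ poch t t n
  gauss-poch t {n} {h} h≤n =
    ≡.subst (λ N → gauss t N h * (poch t t (n ∸ h) * poch t t h) ≈ poch t t N)
            (ℕ.m∸n+n≡m h≤n) (gauss-poch-+ t (n ∸ h) h)

  EqMonGauss-intro : ∀ t {lhs m} n h → lhs ≈ m * gauss t n h → EqMonGauss t lhs m n h
  EqMonGauss-intro t {lhs} {m} n h lhs≈ =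
    (λ h≤n → begin
      lhs * (poch t t (n ∸ h) * poch t t h)               ≈⟨ *-congʳ lhs≈ ⟩
      (m * gauss t n h) * (poch t t (n ∸ h) * poch t t h) ≈⟨ *-assoc _ _ _ ⟩
      m * (gauss t n h * (poch t t (n ∸ h) * poch t t h)) ≈⟨ *-congˡ (gauss-poch t h≤n) ⟩
      m * poch t t n                                      ∎) ,
    (λ n<h → trans lhs≈ (trans (*-congˡ (gauss-above t n<h)) (zeroʳ _)))

  module Monomials (x y : Carrier) where
    x^_y^_ : ℕ → ℕ → Carrier
    x^ i y^ j = pw x i * pw y j

    weight : List ℕ → Carrier
    weight λs = x^ oddSum λs y^ evenSum λs

    x^y^-* : ∀ i j k l → (x^ i y^ j) * (x^ k y^ l) ≈ x^ (i + k) y^ (j + l)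
    x^y^-* i j k l = begin
      (pw x i * pw y j) * (pw x k * pw y l)
        ≈⟨ solve 4 (λ a b c d → (a :* b) :* (c :* d) := (a :* c) :* (b :* d)) ≈-refl _ _ _ _ ⟩
      (pw x i * pw x k) * (pw y j * pw y l)
        ≈⟨ sym (*-cong (pw-+ x i k) (pw-+ y j l)) ⟩
      x^ (i + k) y^ (j + l) ∎

    x^y^-*-* : ∀ i j k l {i′ j′} g → i + k ≡ i′ → j + l ≡ j′ →
               (x^ i y^ j) * ((x^ k y^ l) * g) ≈ (x^ i′ y^ j′) * g
    x^y^-*-* i j k l g refl refl = trans (sym (*-assoc _ _ g)) (*-congʳ (x^y^-* i j k l))

    x^y^-*-pw : ∀ i j k → (x^ i y^ j) * pw (x * y) k ≈ x^ (i + k) y^ (j + k)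
    x^y^-*-pw i j k = trans (*-congˡ (pw-*-distrib x y k)) (x^y^-* i j k k)

    weight-∷∷ : ∀ a b r → weight (a ∷ b ∷ r) ≈ (x^ a y^ b) * weight r
    weight-∷∷ a b r = sym (x^y^-* a b (oddSum r) (evenSum r))

triangle : ℕ → ℕ
triangle zero    = 0
triangle (suc h) = suc h + triangle h

choose₂ : ℕ → ℕ
choose₂ zero    = 0
choose₂ (suc h) = h + choose₂ h

-- The partitions of 𝓑_𝓖 with L₀ parts, listed by largest part: l₀ is the least largest part
-- that occurs, and p₀, q₀ are |λ_o|, |λ_e| of the partition attaining it.
record Base : Set₁ where
  field
    L₀ l₀ p₀ q₀  : ℕ
    1≤L₀         : 1 ≤ L₀
    members      : ℕ → List (List ℕ)
    ∈-members⇔   : ∀ {H z} → z ∈ members H ⇔ IsBG[ L₀ , H ] z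
    members-unique : ∀ H → Unique (members H)
    members-below  : ∀ {H} → H < l₀ → members H ≡ []

module Chains (B : Base) where
  open Base B

  parts : ℕ → ℕ
  parts zero    = L₀
  parts (suc m) = 2 + parts m

  least : ℕ → ℕ
  least zero    = l₀
  least (suc m) = 3 + least m

  -- |λ_o| and |λ_e| of the unique partition with parts m parts and largest part least m
  oddSum₀ : ℕ → ℕ
  oddSum₀ zero    = p₀
  oddSum₀ (suc m) = 3 + least m + oddSum₀ m

  evenSum₀ : ℕ → ℕ
  evenSum₀ zero    = q₀
  evenSum₀ (suc m) = 2 + least m + evenSum₀ m

  -- chains-gap₂ m c: the members of chains (suc m) (3 + c) whose two largest parts differ by 2
  chains : ℕ → ℕ → List (List ℕ)
  chains-gap₂ : ℕ → ℕ → List (List ℕ)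
  chains zero    H                   = members H
  chains (suc m) (suc (suc (suc c))) = map (pair 1 c) (chains m c) ++ chains-gap₂ m c
  chains (suc m) _                   = []
  chains-gap₂ m zero    = []
  chains-gap₂ m (suc c) = map (pair 2 c) (chains m c)

  parts-pos : ∀ m → 1 ≤ parts m
  parts-pos zero    = 1≤L₀
  parts-pos (suc m) = s≤s z≤n

  chains-sound : ∀ m {H z} → z ∈ chains m H → IsBG[ parts m , H ] z
  chains-gap₂-sound : ∀ m c {z} → z ∈ chains-gap₂ m c → IsBG[ 2 + parts m , 3 + c ] z
  chains-sound zero                           = Equivalence.to ∈-members⇔
  chains-sound (suc m) {suc (suc (suc c))} z∈ =
    [ IsBG-map-pair (inj₁ refl) (chains-sound m) , chains-gap₂-sound m c ]′ (∈-++⁻ _ z∈)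
  chains-gap₂-sound m (suc c) = IsBG-map-pair (inj₂ refl) (chains-sound m)

  chains-complete : ∀ m {H z} → IsBG[ parts m , H ] z → z ∈ chains m H
  chains-complete zero                         = Equivalence.from ∈-members⇔
  chains-complete (suc m) {z = a ∷ b ∷ []} ((len , _) , _)
    with () ← ≡.subst (1 ≤_) (≡.sym (ℕ.suc-injective (ℕ.suc-injective len))) (parts-pos m)
  chains-complete (suc m) {z = a ∷ b ∷ c ∷ r} bg with IsBG-unpair bg
  ... | _ , inj₁ refl , refl , refl , bg′ = ∈-++⁺ˡ (∈-map⁺ (pair 1 c) (chains-complete m bg′))
  ... | _ , inj₂ refl , refl , refl , bg′ = ∈-++⁺ʳ _ (∈-map⁺ (pair 2 c) (chains-complete m bg′))

  ∈-chains⇔ : ∀ m {H z} → z ∈ chains m H ⇔ IsBG[ parts m , H ] z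
  ∈-chains⇔ m = mk⇔ (chains-sound m) (chains-complete m)

  chains-unique : ∀ m H → Unique (chains m H)
  chains-gap₂-unique : ∀ m c → Unique (chains-gap₂ m c)
  chains-unique zero    H                   = members-unique H
  chains-unique (suc m) (suc (suc (suc c))) =
    Unique.++⁺ (Unique.map⁺ (pair-injective 1 c) (chains-unique m c)) (chains-gap₂-unique m c) (disjoint c)
    where
    disjoint : ∀ c {z} → ¬ (z ∈ map (pair 1 c) (chains m c) × z ∈ chains-gap₂ m c)
    disjoint (suc c) (z∈₁ , z∈₂) with ∈-map⁻ _ z∈₁ | ∈-map⁻ _ z∈₂
    ... | _ , _ , refl | _ , _ , ()
  chains-unique (suc m) zero                = []
  chains-unique (suc m) (suc zero)          = []
  chains-unique (suc m) (suc (suc zero))    = []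
  chains-gap₂-unique m zero    = []
  chains-gap₂-unique m (suc c) = Unique.map⁺ (pair-injective 2 c) (chains-unique m c)

  chains-below : ∀ m {H} → H < least m → chains m H ≡ []
  chains-gap₂-below : ∀ m {c} → c ≤ least m → chains-gap₂ m c ≡ []
  chains-below zero                                             = members-below
  chains-below (suc m) {zero}                    _              = refl
  chains-below (suc m) {suc zero}                _              = refl
  chains-below (suc m) {suc (suc zero)}          _              = refl
  chains-below (suc m) {suc (suc (suc c))} (s≤s (s≤s (s≤s c<))) =
    ≡.cong₂ _++_ (≡.cong (map (pair 1 c)) (chains-below m c<)) (chains-gap₂-below m (ℕ.<⇒≤ c<))
  chains-gap₂-below m {zero}  _  = refl
  chains-gap₂-below m {suc c} c< = ≡.cong (map (pair 2 c)) (chains-below m c<)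

module ChainSums (B : Base) {a ℓ} (R : CommutativeRing a ℓ) (x y : CommutativeRing.Carrier R) where
  open Base B
  open Chains B
  open CommutativeRing R hiding (refl) renaming (_+_ to _⊕_)
  open Defs.Ring R
  open InCommutativeRing R
  open Monomials x y
  open import Relation.Binary.Reasoning.Setoid setoid

  coeff : ℕ → ℕ → Carrier
  coeff m h = x^ (oddSum₀ m + triangle h) y^ (evenSum₀ m + choose₂ h)

  Σw : List (List ℕ) → Carrier
  Σw zs = sumR (map weight zs)

  Σw-map-pair : ∀ d c rs → Σw (map (pair d c) rs) ≈ (x^ (d + (2 + c)) y^ (2 + c)) * Σw rs
  Σw-map-pair d c = sumR-map-map weight (pair d c) (weight-∷∷ (d + (2 + c)) (2 + c))

  gap₁-sum : ∀ m h {G} → Σw (chains m (least m + h)) ≈ coeff m h * G →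
             Σw (map (pair 1 (least m + h)) (chains m (least m + h))) ≈ coeff (suc m) h * (pw (x * y) h * G)
  gap₁-sum m h {G} Σw≈ = begin
    Σw (map (pair 1 c) (chains m c))                 ≈⟨ Σw-map-pair 1 c (chains m c) ⟩
    (x^ (1 + (2 + c)) y^ (2 + c)) * Σw (chains m c) ≈⟨ *-congˡ Σw≈ ⟩
    (x^ (1 + (2 + c)) y^ (2 + c)) * (coeff m h * G)
      ≈⟨ x^y^-*-* (1 + (2 + c)) (2 + c) X Y G (odd h (least m) (oddSum₀ m) (triangle h))
                                             (even h (least m) (evenSum₀ m) (choose₂ h)) ⟩
    (x^ (X′ + h) y^ (Y′ + h)) * G                   ≈⟨ *-congʳ (sym (x^y^-*-pw X′ Y′ h)) ⟩
    (coeff (suc m) h * pw (x * y) h) * G            ≈⟨ *-assoc _ _ _ ⟩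
    coeff (suc m) h * (pw (x * y) h * G)            ∎
    where
    c = least m + h
    X = oddSum₀ m + triangle h
    Y = evenSum₀ m + choose₂ h
    X′ = oddSum₀ (suc m) + triangle h
    Y′ = evenSum₀ (suc m) + choose₂ h
    odd : ∀ h l X T → 1 + (2 + (l + h)) + (X + T) ≡ 3 + l + X + T + h
    odd = solve-∀
    even : ∀ h l Y C → 2 + (l + h) + (Y + C) ≡ 2 + l + Y + C + h
    even = solve-∀

  gap₂-sum : ∀ m h {G} → Σw (chains m (least m + h)) ≈ coeff m h * G →
             Σw (map (pair 2 (least m + h)) (chains m (least m + h))) ≈ coeff (suc m) (suc h) * G
  gap₂-sum m h {G} Σw≈ = begin
    Σw (map (pair 2 c) (chains m c))                 ≈⟨ Σw-map-pair 2 c (chains m c) ⟩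
    (x^ (2 + (2 + c)) y^ (2 + c)) * Σw (chains m c) ≈⟨ *-congˡ Σw≈ ⟩
    (x^ (2 + (2 + c)) y^ (2 + c)) * (coeff m h * G)
      ≈⟨ x^y^-*-* (2 + (2 + c)) (2 + c) X Y G (odd h (least m) (oddSum₀ m) (triangle h))
                                             (even h (least m) (evenSum₀ m) (choose₂ h)) ⟩
    coeff (suc m) (suc h) * G                        ∎
    where
    c = least m + h
    X = oddSum₀ m + triangle h
    Y = evenSum₀ m + choose₂ h
    odd : ∀ h l X T → 2 + (2 + (l + h)) + (X + T) ≡ 3 + l + X + (suc h + T)
    odd = solve-∀
    even : ∀ h l Y C → 2 + (l + h) + (Y + C) ≡ 2 + l + Y + (h + C)
    even = solve-∀

  base-sum-intro : Σw (members (l₀ + 0)) ≈ coeff 0 0 → Σw (members (l₀ + 1)) ≈ coeff 0 1 →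
                   (∀ h → members (l₀ + suc (suc h)) ≡ []) →
                   ∀ h → Σw (members (l₀ + h)) ≈ coeff 0 h * gauss (x * y) 1 h
  base-sum-intro Σw₀ Σw₁ above zero          = trans Σw₀ (sym (*-identityʳ _))
  base-sum-intro Σw₀ Σw₁ above (suc zero)    =
    trans Σw₁ (sym (trans (*-congˡ (gauss-diag (x * y) 1)) (*-identityʳ _)))
  base-sum-intro Σw₀ Σw₁ above (suc (suc h)) =
    trans (≡⇒≈ (≡.cong Σw (above h)))
          (sym (trans (*-congˡ (gauss-above (x * y) {1} {suc (suc h)} (s≤s (s≤s z≤n)))) (zeroʳ _)))

  module _ (base-sum : ∀ h → Σw (members (l₀ + h)) ≈ coeff 0 h * gauss (x * y) 1 h) where

    chains-sum : ∀ m h → Σw (chains m (least m + h)) ≈ coeff m h * gauss (x * y) (suc m) h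
    chains-sum zero    h       = base-sum h
    chains-sum (suc m) zero    = begin
      Σw (map (pair 1 l) (chains m l) ++ chains-gap₂ m l)
        ≈⟨ sumR-map-++ weight (map (pair 1 l) (chains m l)) _ ⟩
      Σw (map (pair 1 l) (chains m l)) ⊕ Σw (chains-gap₂ m l)
        ≈⟨ +-cong (gap₁-sum m 0 (chains-sum m 0))
                  (≡⇒≈ (≡.cong Σw (chains-gap₂-below m (ℕ.≤-reflexive (ℕ.+-identityʳ _))))) ⟩
      coeff (suc m) 0 * (1# * 1#) ⊕ 0#            ≈⟨ +-identityʳ _ ⟩
      coeff (suc m) 0 * (1# * 1#)                 ≈⟨ *-congˡ (*-identityˡ _) ⟩
      coeff (suc m) 0 * 1#                        ∎
      where
      l = least m + 0
    chains-sum (suc m) (suc h) = begin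
      Σw (map (pair 1 (l + suc h)) (chains m (l + suc h)) ++ chains-gap₂ m (l + suc h))
        ≈⟨ sumR-map-++ weight (map (pair 1 (l + suc h)) (chains m (l + suc h))) _ ⟩
      Σw (map (pair 1 (l + suc h)) (chains m (l + suc h))) ⊕ Σw (chains-gap₂ m (l + suc h))
        ≈⟨ +-congˡ (≡⇒≈ (≡.cong (Σw ∘ chains-gap₂ m) (ℕ.+-suc l h))) ⟩
      Σw (map (pair 1 (l + suc h)) (chains m (l + suc h))) ⊕ Σw (map (pair 2 (l + h)) (chains m (l + h)))
        ≈⟨ +-cong (gap₁-sum m (suc h) (chains-sum m (suc h))) (gap₂-sum m h (chains-sum m h)) ⟩
      X * (pw (x * y) (suc h) * G₂) ⊕ X * G₁       ≈⟨ +-comm _ _ ⟩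
      X * G₁ ⊕ X * (pw (x * y) (suc h) * G₂)       ≈⟨ sym (distribˡ _ _ _) ⟩
      X * gauss (x * y) (suc (suc m)) (suc h)      ∎
      where
      l = least m
      X = coeff (suc m) (suc h)
      G₁ = gauss (x * y) (suc m) h
      G₂ = gauss (x * y) (suc m) (suc h)

    BG≈Σw-chains : ∀ m H → BG x y (parts m) H ≈ Σw (chains m H)
    BG≈Σw-chains m H = sumR-map-unique weight (BGset-unique (parts m) H) (chains-unique m H)
                         (⇔-sym (∈-chains⇔ m) ⇔-∘ ∈-BGset⇔)

    BG-closed : ∀ m h {n H i j} → n ≡ parts m → H ≡ least m + h → i ≡ oddSum₀ m + triangle h →
                j ≡ evenSum₀ m + choose₂ h → EqMonGauss (x * y) (BG x y n H) (x^ i y^ j) (suc m) h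
    BG-closed m h refl refl refl refl =
      EqMonGauss-intro (x * y) (suc m) h (trans (BG≈Σw-chains m (least m + h)) (chains-sum m h))

oddMembers : ℕ → List (List ℕ)
oddMembers 1 = (1 ∷ []) ∷ []
oddMembers 2 = (2 ∷ []) ∷ []
oddMembers _ = []

oddBase : Base
oddBase = record
  { L₀ = 1 ; l₀ = 1 ; p₀ = 1 ; q₀ = 0 ; 1≤L₀ = s≤s z≤n
  ; members = oddMembers
  ; ∈-members⇔ = mk⇔ sound complete
  ; members-unique = unique
  ; members-below = λ { {zero} _ → refl ; {suc _} (s≤s ()) }
  }
  where
  sound : ∀ {H z} → z ∈ oddMembers H → IsBG[ 1 , H ] z
  sound {1} (here refl) = from-yes (shapeBG? 1 1 (1 ∷ []))
  sound {2} (here refl) = from-yes (shapeBG? 1 2 (2 ∷ []))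
  complete : ∀ {H z} → IsBG[ 1 , H ] z → z ∈ oddMembers H
  complete {z = _ ∷ []} ((_ , refl) , _ , _ , _ , inj₁ refl , _) = here refl
  complete {z = _ ∷ []} ((_ , refl) , _ , _ , _ , inj₂ refl , _) = here refl
  unique : ∀ H → Unique (oddMembers H)
  unique 0                   = []
  unique 1                   = [] ∷ []
  unique 2                   = [] ∷ []
  unique (suc (suc (suc _))) = []

evenMembers : ℕ → List (List ℕ)
evenMembers 3 = (3 ∷ 2 ∷ []) ∷ []
evenMembers 4 = (4 ∷ 2 ∷ []) ∷ []
evenMembers _ = []

evenBase : Base
evenBase = record
  { L₀ = 2 ; l₀ = 3 ; p₀ = 3 ; q₀ = 2 ; 1≤L₀ = s≤s z≤n
  ; members = evenMembers
  ; ∈-members⇔ = mk⇔ sound complete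
  ; members-unique = unique
  ; members-below = λ { {0} _ → refl ; {1} _ → refl ; {2} _ → refl
                      ; {suc (suc (suc _))} (s≤s (s≤s (s≤s ()))) }
  }
  where
  sound : ∀ {H z} → z ∈ evenMembers H → IsBG[ 2 , H ] z
  sound {3} (here refl) = from-yes (shapeBG? 2 3 (3 ∷ 2 ∷ []))
  sound {4} (here refl) = from-yes (shapeBG? 2 4 (4 ∷ 2 ∷ []))
  complete : ∀ {H z} → IsBG[ 2 , H ] z → z ∈ evenMembers H
  complete {z = a ∷ b ∷ []} ((_ , max≡H) , lk@(b<a ∷ _) , _ , ((1≤ , ≤2) , _) , _ , even)
    with even refl | gap⇒OneOrTwo b<a 1≤ ≤2 | ≡.trans (≡.sym (foldr-⊔-decreasing lk)) max≡H
  ... | refl | _ , inj₁ refl , refl | refl = here refl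
  ... | refl | _ , inj₂ refl , refl | refl = here refl
  unique : ∀ H → Unique (evenMembers H)
  unique 0                               = []
  unique 1                               = []
  unique 2                               = []
  unique 3                               = [] ∷ []
  unique 4                               = [] ∷ []
  unique (suc (suc (suc (suc (suc _))))) = []

module _ {a ℓ} (R : CommutativeRing a ℓ) (x y : CommutativeRing.Carrier R) where
  open CommutativeRing R using (_≈_; _*_; +-identityʳ)
  open InCommutativeRing R using (gauss)

  oddBase-sum : ∀ h → ChainSums.Σw oddBase R x y (oddMembers (1 + h)) ≈
                      ChainSums.coeff oddBase R x y 0 h * gauss (x * y) 1 h
  oddBase-sum = ChainSums.base-sum-intro oddBase R x y (+-identityʳ _) (+-identityʳ _) (λ _ → refl)

  evenBase-sum : ∀ h → ChainSums.Σw evenBase R x y (evenMembers (3 + h)) ≈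
                       ChainSums.coeff evenBase R x y 0 h * gauss (x * y) 1 h
  evenBase-sum = ChainSums.base-sum-intro evenBase R x y (+-identityʳ _) (+-identityʳ _) (λ _ → refl)

open import Data.Nat using (_*_; _/_)

half : ∀ a {c} → a * 2 ≡ c → c / 2 ≡ a
half a refl = m*n/n≡m a 2

half-∸ : ∀ a b {c} → a * 2 + b ≡ c → (c ∸ b) / 2 ≡ a
half-∸ a b refl = half a (≡.sym (ℕ.m+n∸n≡m (a * 2) b))

triangle-closed : ∀ h → triangle h * 2 ≡ h * h + h
triangle-closed zero    = refl
triangle-closed (suc h) = begin
  (suc h + triangle h) * 2        ≡⟨ split h (triangle h) ⟩
  triangle h * 2 + 2 * suc h      ≡⟨ ≡.cong (_+ 2 * suc h) (triangle-closed h) ⟩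
  h * h + h + 2 * suc h           ≡⟨ square h ⟩
  suc h * suc h + suc h           ∎
  where
  open ≡.≡-Reasoning
  split : ∀ h T → (suc h + T) * 2 ≡ T * 2 + 2 * suc h
  split = solve-∀
  square : ∀ h → h * h + h + 2 * suc h ≡ suc h * suc h + suc h
  square = solve-∀

choose₂-closed : ∀ h → choose₂ h * 2 + h ≡ h * h
choose₂-closed zero    = refl
choose₂-closed (suc h) = begin
  (h + choose₂ h) * 2 + suc h     ≡⟨ split h (choose₂ h) ⟩
  choose₂ h * 2 + h + (2 * h + 1) ≡⟨ ≡.cong (_+ (2 * h + 1)) (choose₂-closed h) ⟩
  h * h + (2 * h + 1)             ≡⟨ square h ⟩
  suc h * suc h                   ∎
  where
  open ≡.≡-Reasoning
  split : ∀ h C → (h + C) * 2 + suc h ≡ C * 2 + h + (2 * h + 1)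
  split = solve-∀
  square : ∀ h → h * h + (2 * h + 1) ≡ suc h * suc h
  square = solve-∀

module ChainsClosed (B : Base) where
  open Base B
  open Chains B
  open ≡.≡-Reasoning

  parts-closed : ∀ m → parts m ≡ 2 * m + L₀
  parts-closed zero    = refl
  parts-closed (suc m) = ≡.trans (≡.cong (2 +_) (parts-closed m)) (step m L₀)
    where
    step : ∀ m L → 2 + (2 * m + L) ≡ 2 * suc m + L
    step = solve-∀

  least-closed : ∀ m → least m ≡ 3 * m + l₀
  least-closed zero    = refl
  least-closed (suc m) = ≡.trans (≡.cong (3 +_) (least-closed m)) (step m l₀)
    where
    step : ∀ m l → 3 + (3 * m + l) ≡ 3 * suc m + l
    step = solve-∀

  oddSum₀-closed : ∀ m → oddSum₀ m * 2 ≡ 3 * m * m + (3 + 2 * l₀) * m + 2 * p₀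
  oddSum₀-closed zero    = start l₀ p₀
    where
    start : ∀ l p → p * 2 ≡ 3 * 0 * 0 + (3 + 2 * l) * 0 + 2 * p
    start = solve-∀
  oddSum₀-closed (suc m) = begin
    (3 + least m + oddSum₀ m) * 2
      ≡⟨ ℕ.*-distribʳ-+ 2 (3 + least m) (oddSum₀ m) ⟩
    (3 + least m) * 2 + oddSum₀ m * 2
      ≡⟨ ≡.cong₂ (λ l s → (3 + l) * 2 + s) (least-closed m) (oddSum₀-closed m) ⟩
    (3 + (3 * m + l₀)) * 2 + (3 * m * m + (3 + 2 * l₀) * m + 2 * p₀)
      ≡⟨ step m l₀ p₀ ⟩
    3 * suc m * suc m + (3 + 2 * l₀) * suc m + 2 * p₀ ∎
    where
    step : ∀ m l p → (3 + (3 * m + l)) * 2 + (3 * m * m + (3 + 2 * l) * m + 2 * p) ≡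
                     3 * suc m * suc m + (3 + 2 * l) * suc m + 2 * p
    step = solve-∀

  evenSum₀-closed : ∀ m → evenSum₀ m * 2 ≡ 3 * m * m + (1 + 2 * l₀) * m + 2 * q₀
  evenSum₀-closed zero    = start l₀ q₀
    where
    start : ∀ l q → q * 2 ≡ 3 * 0 * 0 + (1 + 2 * l) * 0 + 2 * q
    start = solve-∀
  evenSum₀-closed (suc m) = begin
    (2 + least m + evenSum₀ m) * 2
      ≡⟨ ℕ.*-distribʳ-+ 2 (2 + least m) (evenSum₀ m) ⟩
    (2 + least m) * 2 + evenSum₀ m * 2
      ≡⟨ ≡.cong₂ (λ l s → (2 + l) * 2 + s) (least-closed m) (evenSum₀-closed m) ⟩
    (2 + (3 * m + l₀)) * 2 + (3 * m * m + (1 + 2 * l₀) * m + 2 * q₀)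
      ≡⟨ step m l₀ q₀ ⟩
    3 * suc m * suc m + (1 + 2 * l₀) * suc m + 2 * q₀ ∎
    where
    step : ∀ m l q → (2 + (3 * m + l)) * 2 + (3 * m * m + (1 + 2 * l) * m + 2 * q) ≡
                     3 * suc m * suc m + (1 + 2 * l) * suc m + 2 * q
    step = solve-∀

module Odd = Chains oddBase
module OddClosed = ChainsClosed oddBase
module Even = Chains evenBase
module EvenClosed = ChainsClosed evenBase

odd-parts : ∀ m → 2 * suc m ∸ 1 ≡ Odd.parts m
odd-parts m = ≡.trans (≡.cong (_∸ 1) (e m)) (≡.sym (OddClosed.parts-closed m))
  where
  e : ∀ m → 2 * suc m ≡ suc (2 * m + 1)
  e = solve-∀

odd-largest : ∀ m h → 3 * suc m + h ∸ 2 ≡ Odd.least m + h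
odd-largest m h = ≡.trans (≡.cong (_∸ 2) (e m h)) (≡.cong (_+ h) (≡.sym (OddClosed.least-closed m)))
  where
  e : ∀ m h → 3 * suc m + h ≡ 2 + (3 * m + 1 + h)
  e = solve-∀

odd-oddExponent : ∀ m h → (3 * suc m * suc m ∸ suc m) / 2 + (h * h + h) / 2 ≡ Odd.oddSum₀ m + triangle h
odd-oddExponent m h =
  ≡.cong₂ _+_ (half-∸ (Odd.oddSum₀ m) (suc m) (≡.trans (≡.cong (_+ suc m) (OddClosed.oddSum₀-closed m)) (e m))) (half (triangle h) (triangle-closed h))
  where
  e : ∀ m → 3 * m * m + (3 + 2 * 1) * m + 2 * 1 + suc m ≡ 3 * suc m * suc m
  e = solve-∀

odd-evenExponent : ∀ m h → (3 * suc m * suc m ∸ 3 * suc m) / 2 + (h * h ∸ h) / 2 ≡ Odd.evenSum₀ m + choose₂ h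
odd-evenExponent m h =
  ≡.cong₂ _+_ (half-∸ (Odd.evenSum₀ m) (3 * suc m) (≡.trans (≡.cong (_+ 3 * suc m) (OddClosed.evenSum₀-closed m)) (e m))) (half-∸ (choose₂ h) h (choose₂-closed h))
  where
  e : ∀ m → 3 * m * m + (1 + 2 * 1) * m + 2 * 0 + 3 * suc m ≡ 3 * suc m * suc m
  e = solve-∀

even-parts : ∀ m → 2 * suc m ≡ Even.parts m
even-parts m = ≡.trans (e m) (≡.sym (EvenClosed.parts-closed m))
  where
  e : ∀ m → 2 * suc m ≡ 2 * m + 2
  e = solve-∀

even-largest : ∀ m h → 3 * suc m + h ≡ Even.least m + h
even-largest m h = ≡.trans (e m h) (≡.cong (_+ h) (≡.sym (EvenClosed.least-closed m)))
  where
  e : ∀ m h → 3 * suc m + h ≡ 3 * m + 3 + h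
  e = solve-∀

even-oddExponent : ∀ m h → (3 * suc m * suc m + 3 * suc m) / 2 + (h * h + h) / 2 ≡ Even.oddSum₀ m + triangle h
even-oddExponent m h = ≡.cong₂ _+_ (half (Even.oddSum₀ m) (≡.trans (EvenClosed.oddSum₀-closed m) (e m))) (half (triangle h) (triangle-closed h))
  where
  e : ∀ m → 3 * m * m + (3 + 2 * 3) * m + 2 * 3 ≡ 3 * suc m * suc m + 3 * suc m
  e = solve-∀

even-evenExponent : ∀ m h → (3 * suc m * suc m + suc m) / 2 + (h * h ∸ h) / 2 ≡ Even.evenSum₀ m + choose₂ h
even-evenExponent m h = ≡.cong₂ _+_ (half (Even.evenSum₀ m) (≡.trans (EvenClosed.evenSum₀-closed m) (e m))) (half-∸ (choose₂ h) h (choose₂-closed h))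
  where
  e : ∀ m → 3 * m * m + (1 + 2 * 3) * m + 2 * 2 ≡ 3 * suc m * suc m + suc m
  e = solve-∀

theorem5p3 : ∀ {c ℓ} (R : CommutativeRing c ℓ) (x y : CommutativeRing.Carrier R) (n h : ℕ) → 1 ≤ n →
    Ring.EqMonGauss R (CommutativeRing._*_ R x y)
      (Ring.BG R x y (2 * n ∸ 1) (3 * n + h ∸ 2))
      (CommutativeRing._*_ R
        (Ring.pw R x ((3 * n * n ∸ n) / 2 + (h * h + h) / 2))
        (Ring.pw R y ((3 * n * n ∸ 3 * n) / 2 + (h * h ∸ h) / 2)))
      n h
    × Ring.EqMonGauss R (CommutativeRing._*_ R x y)
      (Ring.BG R x y (2 * n) (3 * n + h))
      (CommutativeRing._*_ R
        (Ring.pw R x ((3 * n * n + 3 * n) / 2 + (h * h + h) / 2))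
        (Ring.pw R y ((3 * n * n + n) / 2 + (h * h ∸ h) / 2)))
      n h
theorem5p3 R x y (suc m) h _ =
  ChainSums.BG-closed oddBase R x y (oddBase-sum R x y) m h
    (odd-parts m) (odd-largest m h) (odd-oddExponent m h) (odd-evenExponent m h) ,
  ChainSums.BG-closed evenBase R x y (evenBase-sum R x y) m h
    (even-parts m) (even-largest m h) (even-oddExponent m h) (even-evenExponent m h)
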